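{- Let $k \ge 2$ and $m \ge 1$ be integers and $n = km$. Let $Z=\langle z_1, z_2, \ldots, z_{km}\rangle$ be a position of $\frac{k-1}{k}n$-delete Nim, where $z_1 \le z_2 \le \cdots \le z_{km}$ are positive integers. Let $k^s$ be the smallest power of $k$ strictly greater than $z_{(k-1)m+1}$. Then $Z$ is a $\mathcal{P}$-position if and only if both of the following hold: (a) all of $z_1, z_2, \ldots, z_{(k-1)m+1}$ are $k$-oddoid; (b) for every $l \in \{1,\ldots,km\}$, if $z_l$ is $k$-evenoid then $k^s \le z_l$.
   Context: For an integer $k\ge 2$, a positive integer is called $k$-oddoid if its remainder upon division by $k(k-1)$ lies between $1$ and $k-1$ (inclusive); every other positive integer is called $k$-evenoid. $\frac{k-1}{k}n$-delete Nim with $n = km$ heaps: a position is a $km$-tuple of positive integers (heap sizes). Two players alternate moves. A move consists of selecting $(k-1)m$ heaps and deleting them, and then splitting each of the remaining $m$ heaps into $k$ heaps, each containing at least one token (so the number of heaps stays $km$). Normal play convention: a player who cannot move loses. A $\mathcal{P}$-position is a position from which the player about to move has no winning strategy. -}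

module Defs where

open import Data.Nat using (ℕ; zero; suc; _+_; _*_; _∸_; _^_; _≤_; _<_)
open import Data.Fin using (Fin; toℕ; remQuot)
import Data.Fin as F
open import Data.Product using (Σ; ∃; _×_; _,_; proj₁; proj₂)
open import Relation.Binary.PropositionalEquality using (_≡_)
open import Relation.Nullary using (¬_)
open import Function.Definitions using (Injective)

sumF : ∀ {n} → (Fin n → ℕ) → ℕ
sumF {zero} f = 0
sumF {suc n} f = f F.zero + sumF (λ i → f (F.suc i))

-- n is k-oddoid: its remainder upon division by k(k-1) lies in [1, k-1]
-- (written as the division identity n = q·k(k-1) + r with 1 ≤ r ≤ k-1;
--  for k ≥ 2 such r is the remainder since r < k(k-1))
Oddoid : ℕ → ℕ → Set
Oddoid k n = Σ ℕ λ q → Σ ℕ λ r → (n ≡ q * (k * (k ∸ 1)) + r) × (1 ≤ r) × (r ≤ k ∸ 1)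

Evenoid : ℕ → ℕ → Set
Evenoid k n = ¬ Oddoid k n

Position : ℕ → ℕ → Set
Position k m = Fin (k * m) → ℕ

-- Move k m Z Z' : Z' is reachable from Z in one move.
-- keep : the m heaps that are kept (injective, i.e. m distinct heaps; the
--        other (k-1)m heaps are deleted);
-- parts i j : the j-th of the k pieces heap keep i is split into
--        (each ≥ 1, summing to the heap size).
-- The new km-tuple lists the pieces in the order given by remQuot
-- (heap order is irrelevant to the game).
record Move (k m : ℕ) (Z Z' : Position k m) : Set where
  field
    keep      : Fin m → Fin (k * m)
    keep-inj  : Injective _≡_ _≡_ keep
    parts     : Fin m → Fin k → ℕ
    parts-pos : ∀ i j → 1 ≤ parts i j
    parts-sum : ∀ i → sumF (parts i) ≡ Z (keep i)
    result    : ∀ x → Z' x ≡ parts (proj₂ (remQuot {k} m x)) (proj₁ (remQuot {k} m x))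

-- Normal play outcome classes, defined inductively (the game is finite:
-- the total number of tokens strictly decreases).
data PPos (k m : ℕ) (Z : Position k m) : Set
data NPos (k m : ℕ) (Z : Position k m) : Set

data PPos k m Z where
  ppos : (∀ Z' → Move k m Z Z' → NPos k m Z') → PPos k m Z

data NPos k m Z where
  npos : (Z' : Position k m) → Move k m Z Z' → PPos k m Z' → NPos k m Z

{-# OPTIONS --safe #-}
module Submission where

-- Let N = k(k - 1).  The residues mod N of k oddoids add up to a number in [k, N], so a sum of
-- k oddoids is evenoid; and k ^ (u + 1) ≡ k mod N.  Call a position Good when no evenoid heap z
-- with k ^ u ≤ z < k ^ (u + 1) coexists with m heaps of size at least k ^ u.  Every move from a
-- Good position leads to a Bad one and from a Bad position some move leads to a Good one, so the
-- Good positions are the P-positions.  For sorted heaps, m heaps of size at least k ^ u exist iff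
-- k ^ u ≤ z_{(k-1)m+1}, which turns Goodness into conditions (a) and (b).

open import Defs
open import Data.Nat using (ℕ; zero; suc; _+_; _*_; _∸_; _^_; _≤_; _<_; z≤n; s≤s; s≤s⁻¹; _≤?_)
open import Data.Nat.Properties
open import Data.Nat.DivMod using (_%_; _/_; m≡m%n+[m/n]*n; [m+kn]%n≡m%n; m<n⇒m%n≡m; m%n<n)
open import Data.Nat.Tactic.RingSolver using (solve-∀)
open import Data.Fin using (Fin; toℕ; fromℕ<; remQuot; combine) renaming (zero to fz; suc to fs)
import Data.Fin.Properties as Fin
open import Data.Vec.Functional using (_∷_)
open import Data.Product using (Σ; ∃; ∃₂; _×_; _,_; proj₁; proj₂; uncurry)
open import Data.Sum using (_⊎_; inj₁; inj₂; [_,_]′)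
open import Data.Empty using (⊥; ⊥-elim)
open import Function using (_∘_; const; flip)
open import Function.Definitions using (Injective)
open import Function.Bundles using (_⇔_; mk⇔)
open import Relation.Binary.PropositionalEquality
open import Relation.Nullary using (¬_; yes; no; contradiction)
open import Relation.Unary using (Decidable)

sumF-cong : ∀ {n} {f g : Fin n → ℕ} → f ≗ g → sumF f ≡ sumF g
sumF-cong {zero} _ = refl
sumF-cong {suc n} f≗g = cong₂ _+_ (f≗g fz) (sumF-cong (f≗g ∘ fs))

sumF-mono-≤ : ∀ {n} {f g : Fin n → ℕ} → (∀ j → f j ≤ g j) → sumF f ≤ sumF g
sumF-mono-≤ {zero} _ = z≤n
sumF-mono-≤ {suc n} f≤g = +-mono-≤ (f≤g fz) (sumF-mono-≤ (f≤g ∘ fs))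

sumF-const : ∀ n c → sumF {n} (const c) ≡ n * c
sumF-const zero c = refl
sumF-const (suc n) c = cong (c +_) (sumF-const n c)

*≤sumF : ∀ {n} a {f : Fin n → ℕ} → (∀ j → a ≤ f j) → n * a ≤ sumF f
*≤sumF {n} a a≤f = subst (_≤ _) (sumF-const n a) (sumF-mono-≤ a≤f)

sumF≤* : ∀ {n} b {f : Fin n → ℕ} → (∀ j → f j ≤ b) → sumF f ≤ n * b
sumF≤* {n} b f≤b = subst (_ ≤_) (sumF-const n b) (sumF-mono-≤ f≤b)

sumF-linear : ∀ {n} N (q r : Fin n → ℕ) → sumF (λ j → q j * N + r j) ≡ sumF q * N + sumF r
sumF-linear {zero} N q r = refl
sumF-linear {suc n} N q r = begin
  q fz * N + r fz + sumF (λ j → q (fs j) * N + r (fs j))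
    ≡⟨ cong (q fz * N + r fz +_) (sumF-linear N (q ∘ fs) (r ∘ fs)) ⟩
  q fz * N + r fz + (sumF (q ∘ fs) * N + sumF (r ∘ fs))
    ≡⟨ interchange (q fz) (r fz) (sumF (q ∘ fs)) (sumF (r ∘ fs)) N ⟩
  (q fz + sumF (q ∘ fs)) * N + (r fz + sumF (r ∘ fs)) ∎
  where
  open ≡-Reasoning
  interchange : ∀ a b c d N → a * N + b + (c * N + d) ≡ (a + c) * N + (b + d)
  interchange = solve-∀

f≤sumF : ∀ {n} (f : Fin n → ℕ) j → f j ≤ sumF f
f≤sumF f fz = m≤m+n _ _
f≤sumF f (fs j) = ≤-trans (f≤sumF (f ∘ fs) j) (m≤n+m _ _)

f<sumF : ∀ {n} (f : Fin (suc (suc n)) → ℕ) → (∀ j → 1 ≤ f j) → ∀ j → f j < sumF f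
f<sumF f f-pos fz = m<m+n (f fz) (≤-trans (f-pos (fs fz)) (f≤sumF (f ∘ fs) fz))
f<sumF f f-pos (fs j) = ≤-<-trans (f≤sumF (f ∘ fs) j) (m<n+m _ (f-pos fz))

argmin : ∀ {n} (f : Fin (suc n) → ℕ) → ∃ λ i → ∀ j → f i ≤ f j
argmin {zero} f = fz , λ { fz → ≤-refl }
argmin {suc n} f with argmin (f ∘ fs)
... | i , min with f fz ≤? f (fs i)
...   | yes f0≤ = fz , λ { fz → ≤-refl ; (fs j) → ≤-trans f0≤ (min j) }
...   | no f0≰ = fs i , λ { fz → <⇒≤ (≰⇒> f0≰) ; (fs j) → min j }

argmax : ∀ {n} (f : Fin (suc n) → ℕ) → ∃ λ i → ∀ j → f j ≤ f i
argmax {zero} f = fz , λ { fz → ≤-refl }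
argmax {suc n} f with argmax (f ∘ fs)
... | i , max with f (fs i) ≤? f fz
...   | yes ≤f0 = fz , λ { fz → ≤-refl ; (fs j) → ≤-trans (max j) ≤f0 }
...   | no ≰f0 = fs i , λ { fz → <⇒≤ (≰⇒> ≰f0) ; (fs j) → max j }

split-bounded : ∀ n L H x → n * L ≤ x → x ≤ n * H →
  Σ (Fin n → ℕ) λ f → (∀ j → L ≤ f j) × (∀ j → f j ≤ H) × sumF f ≡ x
split-bounded zero L H x _ x≤0 = (λ ()) , (λ ()) , (λ ()) , sym (n≤0⇒n≡0 x≤0)
split-bounded (suc n) L H x lo hi with L + n * H ≤? x
... | yes room with split-bounded n L H (n * H) (*-monoʳ-≤ n L≤H) ≤-refl
  where L≤H : L ≤ H
        L≤H = *-cancelˡ-≤ (suc n) (≤-trans lo hi)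
...   | f , L≤f , f≤H , Σf =
  (x ∸ n * H) ∷ f ,
  (λ { fz → m+n≤o⇒m≤o∸n L room ; (fs j) → L≤f j }) ,
  (λ { fz → m≤n+o⇒m∸n≤o x (n * H) (subst (x ≤_) (+-comm H (n * H)) hi) ; (fs j) → f≤H j }) ,
  trans (cong (x ∸ n * H +_) Σf) (m∸n+n≡m (m+n≤o⇒n≤o L room))
split-bounded (suc n) L H x lo hi | no no-room
  with split-bounded n L H (x ∸ L) (m+n≤o⇒m≤o∸n (n * L) (subst (_≤ x) (+-comm L (n * L)) lo))
                                   (m≤n+o⇒m∸n≤o x L (<⇒≤ (≰⇒> no-room)))
... | f , L≤f , f≤H , Σf =
  L ∷ f ,
  (λ { fz → ≤-refl ; (fs j) → L≤f j }) ,
  (λ { fz → *-cancelˡ-≤ (suc n) (≤-trans lo hi) ; (fs j) → f≤H j }) ,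
  trans (cong (L +_) Σf) (m+[n∸m]≡n (m+n≤o⇒m≤o L lo))

∷-injective : ∀ {n} {A : Set} {e : A} {h : Fin n → A} → Injective _≡_ _≡_ h → (∀ j → h j ≢ e) →
  Injective _≡_ _≡_ (e ∷ h)
∷-injective h-inj h≢e {fz} {fz} _ = refl
∷-injective h-inj h≢e {fz} {fs j} e≡hj = contradiction (sym e≡hj) (h≢e j)
∷-injective h-inj h≢e {fs i} {fz} hi≡e = contradiction hi≡e (h≢e i)
∷-injective h-inj h≢e {fs i} {fs j} hi≡hj = cong fs (h-inj hi≡hj)

module Avoiding {m′ n} (g : Fin (suc m′) → Fin n) (g-inj : Injective _≡_ _≡_ g) (e : Fin n) where

  avoid : Fin m′ → Fin n
  avoid j with g (fs j) Fin.≟ e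
  ... | yes _ = g fz
  ... | no _ = g (fs j)

  avoid-image : ∀ j → ∃ λ i → avoid j ≡ g i
  avoid-image j with g (fs j) Fin.≟ e
  ... | yes _ = fz , refl
  ... | no _ = fs j , refl

  avoid≢e : ∀ j → avoid j ≢ e
  avoid≢e j with g (fs j) Fin.≟ e
  ... | yes gj≡e = λ g0≡e → Fin.0≢1+n (g-inj (trans g0≡e (sym gj≡e)))
  ... | no gj≢e = gj≢e

  avoid-injective : Injective _≡_ _≡_ avoid
  avoid-injective {i} {j} eq with g (fs i) Fin.≟ e | g (fs j) Fin.≟ e
  ... | yes gi≡e | yes gj≡e = Fin.suc-injective (g-inj (trans gi≡e (sym gj≡e)))
  ... | yes _ | no _ = contradiction (g-inj eq) Fin.0≢1+n
  ... | no _ | yes _ = contradiction (sym (g-inj eq)) Fin.0≢1+n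
  ... | no _ | no _ = Fin.suc-injective (g-inj eq)

-- k = 2 + k′ throughout, so that k ∸ 1 and k(k-1) compute.
module Residues (k′ : ℕ) where

  k N : ℕ
  k = suc (suc k′)
  N = k * suc k′

  k-1<N : suc k′ < N
  k-1<N = m<m+n (suc k′) (s≤s z≤n)

  k≤N : k ≤ N
  k≤N = subst (_≤ N) (+-comm (suc k′) 1) (+-monoʳ-≤ (suc k′) (s≤s z≤n))

  %N-unique : ∀ {n} q {r} → n ≡ q * N + r → r < N → n % N ≡ r
  %N-unique {n} q {r} n≡ r<N = begin
    n % N           ≡⟨ cong (_% N) (trans n≡ (+-comm (q * N) r)) ⟩
    (r + q * N) % N ≡⟨ [m+kn]%n≡m%n r q N ⟩
    r % N           ≡⟨ m<n⇒m%n≡m r<N ⟩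
    r               ∎
    where open ≡-Reasoning

  n≡[n/N]*N+n%N : ∀ n → n ≡ n / N * N + n % N
  n≡[n/N]*N+n%N n = trans (m≡m%n+[m/n]*n n N) (+-comm (n % N) _)

  oddoid⇒residue : ∀ {n} → Oddoid k n → 1 ≤ n % N × n % N ≤ suc k′
  oddoid⇒residue {n} (q , r , n≡ , 1≤r , r≤) =
    subst (1 ≤_) (sym n%N≡r) 1≤r , subst (_≤ suc k′) (sym n%N≡r) r≤
    where n%N≡r : n % N ≡ r
          n%N≡r = %N-unique q n≡ (≤-<-trans r≤ k-1<N)

  oddoid? : Decidable (Oddoid k)
  oddoid? n with 1 ≤? n % N | n % N ≤? suc k′
  ... | yes 1≤r | yes r≤ = yes (n / N , n % N , n≡[n/N]*N+n%N n , 1≤r , r≤)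
  ... | no 1≰r | _ = no (1≰r ∘ proj₁ ∘ oddoid⇒residue)
  ... | _ | no r≰ = no (r≰ ∘ proj₂ ∘ oddoid⇒residue)

  oddoid-pos : ∀ {n} → Oddoid k n → 1 ≤ n
  oddoid-pos (q , r , n≡ , 1≤r , _) = subst (1 ≤_) (sym n≡) (≤-trans 1≤r (m≤n+m r (q * N)))

  oddoid-window : ∀ p {x} → p * N + 1 ≤ x → x ≤ p * N + suc k′ → Oddoid k x
  oddoid-window p {x} lo hi =
    p , x ∸ p * N , sym (m+[n∸m]≡n (≤-trans (m≤m+n (p * N) 1) lo)) ,
    m+n≤o⇒m≤o∸n 1 (subst (_≤ x) (+-comm (p * N) 1) lo) , m≤n+o⇒m∸n≤o x (p * N) hi

  evenoid⇒k≤ : ∀ {x} → Evenoid k x → 1 ≤ x → k ≤ x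
  evenoid⇒k≤ {x} ev 1≤x with k ≤? x
  ... | yes k≤x = k≤x
  ... | no k≰x = contradiction (0 , x , refl , 1≤x , s≤s⁻¹ (≰⇒> k≰x)) ev

  k*[pN+k]≡[kp+1]N+k : ∀ p → k * (p * N + k) ≡ (k * p + 1) * N + k
  k*[pN+k]≡[kp+1]N+k = expand k′
    where
    expand : ∀ k′ p → suc (suc k′) * (p * (suc (suc k′) * suc k′) + suc (suc k′))
                    ≡ (suc (suc k′) * p + 1) * (suc (suc k′) * suc k′) + suc (suc k′)
    expand = solve-∀

  k^suc≡ : ∀ u → ∃ λ p → k ^ suc u ≡ p * N + k
  k^suc≡ zero = 0 , *-identityʳ k
  k^suc≡ (suc u) with k^suc≡ u
  ... | p , k^u≡ = k * p + 1 , trans (cong (k *_) k^u≡) (k*[pN+k]≡[kp+1]N+k p)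

  oddoid-below-power : ∀ u {x} → k ^ suc u ≤ x + suc k′ → x < k ^ suc u → Oddoid k x
  oddoid-below-power u {x} lo hi with k^suc≡ u
  ... | p , k^u≡ = oddoid-window p
    (+-cancelʳ-≤ (suc k′) (p * N + 1) x (subst (_≤ x + suc k′) (trans k^u≡ (sym (+-assoc (p * N) 1 (suc k′)))) lo))
    (s≤s⁻¹ (subst (x <_) (trans k^u≡ (+-suc (p * N) (suc k′))) hi))

  evenoid-residue : ∀ {h} → Evenoid k h → 1 ≤ h → ∃₂ λ q r → h ≡ q * N + r × k ≤ r × r ≤ N
  evenoid-residue {h} ev 1≤h with h / N | h % N | n≡[n/N]*N+n%N h | m%n<n h N
  ... | zero | zero | h≡0 | _ = contradiction h≡0 (≢-sym (<⇒≢ 1≤h))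
  ... | suc q | zero | h≡ | _ = q , N , trans h≡ (trans (+-identityʳ (N + q * N)) (+-comm N (q * N))) , k≤N , ≤-refl
  ... | q | suc r | h≡ | r<N with suc r ≤? suc k′
  ...   | yes r≤ = contradiction (q , suc r , h≡ , s≤s z≤n , r≤) ev
  ...   | no r≰ = q , suc r , h≡ , ≰⇒> r≰ , <⇒≤ r<N

  sum-of-oddoids-evenoid : (f : Fin k → ℕ) → (∀ j → Oddoid k (f j)) → Evenoid k (sumF f)
  sum-of-oddoids-evenoid f odd oddΣ = [ ΣR<N-impossible , ΣR≡N-impossible ]′ (m≤n⇒m<n∨m≡n ΣR≤N)
    where
    Q R : Fin k → ℕ
    Q j = proj₁ (odd j)
    R j = proj₁ (proj₂ (odd j))
    Σf≡ : sumF f ≡ sumF Q * N + sumF R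
    Σf≡ = trans (sumF-cong (λ j → proj₁ (proj₂ (proj₂ (odd j))))) (sumF-linear N Q R)
    k≤ΣR : k ≤ sumF R
    k≤ΣR = subst (_≤ sumF R) (*-identityʳ k) (*≤sumF 1 (λ j → proj₁ (proj₂ (proj₂ (proj₂ (odd j))))))
    ΣR≤N : sumF R ≤ N
    ΣR≤N = sumF≤* (suc k′) (λ j → proj₂ (proj₂ (proj₂ (proj₂ (odd j)))))
    ΣR<N-impossible : sumF R < N → ⊥
    ΣR<N-impossible ΣR<N = <⇒≱ (s≤s (proj₂ (oddoid⇒residue oddΣ)))
      (subst (k ≤_) (sym (%N-unique (sumF Q) Σf≡ ΣR<N)) k≤ΣR)
    ΣR≡N-impossible : sumF R ≡ N → ⊥
    ΣR≡N-impossible ΣR≡N = <⇒≢ (proj₁ (oddoid⇒residue oddΣ))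
      (sym (%N-unique (suc (sumF Q)) (trans Σf≡ (trans (cong (sumF Q * N +_) ΣR≡N) (shift (sumF Q) N))) (s≤s z≤n)))
      where shift : ∀ a N → a * N + N ≡ suc a * N + 0
            shift = solve-∀

  quotient-bound : ∀ {h p} q {r} → h ≡ q * N + r → k ≤ r → h < k * (p * N + k) → q ≤ k * p
  quotient-bound {h} {p} q {r} h≡ k≤r h< with q ≤? k * p
  ... | yes q≤kp = q≤kp
  ... | no q≰kp = contradiction h< (≤⇒≯ (begin
    k * (p * N + k)     ≡⟨ k*[pN+k]≡[kp+1]N+k p ⟩
    (k * p + 1) * N + k ≤⟨ +-mono-≤ (*-monoˡ-≤ N (subst (_≤ q) (+-comm 1 (k * p)) (≰⇒> q≰kp))) k≤r ⟩
    q * N + r           ≡⟨ h≡ ⟨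
    h                   ∎))
    where open ≤-Reasoning

  -- Split the quotient and the residue of h separately.
  evenoid-split : ∀ u {h} → Evenoid k h → 1 ≤ h → h < k * k ^ suc u →
    Σ (Fin k → ℕ) λ f → (∀ j → Oddoid k (f j)) × (∀ j → f j < k ^ suc u) × sumF f ≡ h
  evenoid-split u {h} ev 1≤h h< with k^suc≡ u | evenoid-residue ev 1≤h
  ... | p , T≡ | q , r , h≡ , k≤r , r≤N
    with split-bounded k 0 p q (≤-trans (≤-reflexive (*-zeroʳ k)) z≤n)
                               (quotient-bound {p = p} q h≡ k≤r (subst (λ T → h < k * T) T≡ h<))
       | split-bounded k 1 (suc k′) r (subst (_≤ r) (sym (*-identityʳ k)) k≤r) r≤N
  ... | a , _ , a≤p , Σa | b , 1≤b , b≤ , Σb =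
    f , (λ j → a j , b j , refl , 1≤b j , b≤ j) , f<T , Σf
    where
    f : Fin k → ℕ
    f j = a j * N + b j
    f<T : ∀ j → f j < k ^ suc u
    f<T j = subst (f j <_) (sym T≡) (+-mono-≤-< (*-monoˡ-≤ N (a≤p j)) (s≤s (b≤ j)))
    Σf : sumF f ≡ h
    Σf = trans (sumF-linear N a b) (trans (cong₂ (λ x y → x * N + y) Σa Σb) (sym h≡))

  k≤k^suc : ∀ u → k ≤ k ^ suc u
  k≤k^suc u = subst (_≤ k ^ suc u) (*-identityʳ k) (^-monoʳ-≤ k {1} {suc u} (s≤s z≤n))

  x<k*x : ∀ {x} → 1 ≤ x → x < k * x
  x<k*x {x} 1≤x = m<m+n x (≤-trans 1≤x (m≤m+n x _))

  level : ∀ n → 1 ≤ n → ∃ λ u → k ^ u ≤ n × n < k ^ suc u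
  level (suc zero) _ = 0 , ≤-refl , s≤s (s≤s z≤n)
  level (suc (suc n)) _ with level (suc n) (s≤s z≤n)
  ... | u , lo , hi with suc (suc n) <? k ^ suc u
  ...   | yes below = u , ≤-trans lo (n≤1+n _) , below
  ...   | no ¬below = suc u , ≮⇒≥ ¬below , ≤-<-trans hi (x<k*x (m^n>0 k (suc u)))

module Game (k′ m′ : ℕ) where
  open Residues k′

  m : ℕ
  m = suc m′

  Big : Position k m → ℕ → Set
  Big Z v = Σ (Fin m → Fin (k * m)) λ g → Injective _≡_ _≡_ g × (∀ j → v ≤ Z (g j))

  Good : Position k m → Set
  Good Z = ∀ u → Big Z (k ^ u) → ∀ x → Evenoid k (Z x) → k ^ u ≤ Z x → k ^ suc u ≤ Z x

  Bad : Position k m → Set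
  Bad Z = Σ ℕ λ u → Big Z (k ^ u) × Σ (Fin (k * m)) λ x →
            Evenoid k (Z x) × k ^ u ≤ Z x × Z x < k ^ suc u

  Big-anti : ∀ {Z v w} → v ≤ w → Big Z w → Big Z v
  Big-anti v≤w (g , g-inj , w≤) = g , g-inj , λ j → ≤-trans v≤w (w≤ j)

  few-large⇒¬Big : ∀ {Z v} (ι : Fin m′ → Fin (k * m)) → (∀ x → v ≤ Z x → ∃ λ p → x ≡ ι p) → ¬ Big Z v
  few-large⇒¬Big ι covered (g , g-inj , v≤g) = no-collision (Fin.pigeonhole (n<1+n m′) (proj₁ ∘ cover))
    where
    cover : ∀ j → ∃ λ p → g j ≡ ι p
    cover j = covered (g j) (v≤g j)
    no-collision : ¬ ∃₂ λ i j → toℕ i < toℕ j × proj₁ (cover i) ≡ proj₁ (cover j)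
    no-collision (i , j , i<j , same) =
      <-irrefl (cong toℕ (g-inj (trans (proj₂ (cover i)) (trans (cong ι same) (sym (proj₂ (cover j))))))) i<j

  evenoids-above⇒Good : ∀ {Z} t → ¬ Big Z (k ^ t) → (∀ x → Evenoid k (Z x) → k ^ t ≤ Z x) → Good Z
  evenoids-above⇒Good {Z} t ¬big above u big x ev _ with suc u ≤? t
  ... | yes u<t = ≤-trans (^-monoʳ-≤ k u<t) (above x ev)
  ... | no u≮t = contradiction (Big-anti {Z} (^-monoʳ-≤ k (≮⇒≥ u≮t)) big) ¬big

  module _ {Z Z′ : Position k m} (mv : Move k m Z Z′) where
    open Move mv

    part≤heap : ∀ i t → parts i t ≤ Z (keep i)
    part≤heap i t = subst (parts i t ≤_) (parts-sum i) (f≤sumF (parts i) t)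

    heap-pos : ∀ i → 1 ≤ Z (keep i)
    heap-pos i = ≤-trans (parts-pos i fz) (part≤heap i fz)

    result-combine : ∀ t i → Z′ (combine t i) ≡ parts i t
    result-combine t i = trans (result (combine t i)) (cong (uncurry (flip parts)) (Fin.remQuot-combine t i))

    parts-Big : ∀ {v} (sel : Fin m → Fin k) → (∀ j → v ≤ parts j (sel j)) → Big Z′ v
    parts-Big sel v≤ =
      (λ j → combine (sel j) j) ,
      (λ {i} {j} eq → Fin.combine-injectiveʳ (sel i) i (sel j) j eq) ,
      λ j → subst (_ ≤_) (sym (result-combine (sel j) j)) (v≤ j)

    move-shrinks : ∀ {B} → (∀ x → Z x ≤ suc B) → ∀ x → Z′ x ≤ B
    move-shrinks Z≤ x = s≤s⁻¹ (begin-strict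
      Z′ x                ≡⟨ result x ⟩
      parts i t           <⟨ f<sumF (parts i) (parts-pos i) t ⟩
      sumF (parts i)      ≡⟨ parts-sum i ⟩
      Z (keep i)          ≤⟨ Z≤ (keep i) ⟩
      suc _               ∎)
      where
      open ≤-Reasoning
      t : Fin k
      t = proj₁ (remQuot {k} m x)
      i : Fin m
      i = proj₂ (remQuot {k} m x)

  -- Every kept heap carries an evenoid: itself, or (a sum of k oddoids being evenoid) one of its
  -- parts.  At the smallest such witness, of level u, the kept heaps show Big Z (k ^ u); so the
  -- witness is a part, and every kept heap yields a part of size at least k ^ u.
  Good⇒moves-to-Bad : ∀ {Z Z′} → Good Z → Move k m Z Z′ → Bad Z′
  Good⇒moves-to-Bad {Z} {Z′} good mv = bad-at (witness i*) (proj₂ (argmin ρ))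
    where
    open Move mv

    Witness : Fin m → Set
    Witness i = Evenoid k (Z (keep i)) ⊎ ∃ λ t → Evenoid k (parts i t)

    witness : ∀ i → Witness i
    witness i with oddoid? (Z (keep i))
    ... | no ev = inj₁ ev
    ... | yes odd = inj₂ (Fin.¬∀⟶∃¬ k _ (oddoid? ∘ parts i) λ all-odd →
            sum-of-oddoids-evenoid (parts i) all-odd (subst (Oddoid k) (sym (parts-sum i)) odd))

    size : ∀ i → Witness i → ℕ
    size i (inj₁ _) = Z (keep i)
    size i (inj₂ (t , _)) = parts i t

    size≤heap : ∀ i w → size i w ≤ Z (keep i)
    size≤heap i (inj₁ _) = ≤-refl
    size≤heap i (inj₂ (t , _)) = part≤heap mv i t

    size-pos : ∀ i w → 1 ≤ size i w
    size-pos i (inj₁ _) = heap-pos mv i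
    size-pos i (inj₂ (t , _)) = parts-pos i t

    ρ : Fin m → ℕ
    ρ i = size i (witness i)

    i* : Fin m
    i* = proj₁ (argmin ρ)

    kept-Big : ∀ {v} → (∀ j → v ≤ ρ j) → Big Z v
    kept-Big v≤ρ = keep , keep-inj , λ j → ≤-trans (v≤ρ j) (size≤heap j (witness j))

    large-part : ∀ {u} → Big Z (k ^ u) → ∀ j (w : Witness j) → k ^ u ≤ size j w → ∃ λ t → k ^ u ≤ parts j t
    large-part big j (inj₂ (t , _)) le = t , le
    large-part {u} big j (inj₁ ev) le with argmax (parts j)
    ... | t , max = t , *-cancelˡ-≤ k (begin
      k ^ suc u      ≤⟨ good u big (keep j) ev le ⟩
      Z (keep j)     ≡⟨ parts-sum j ⟨
      sumF (parts j) ≤⟨ sumF≤* (parts j t) max ⟩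
      k * parts j t  ∎)
      where open ≤-Reasoning

    bad-at : (w : Witness i*) → (∀ j → size i* w ≤ ρ j) → Bad Z′
    bad-at w min with level (size i* w) (size-pos i* w)
    bad-at (inj₁ ev) min | u , lo , hi =
      contradiction (good u (kept-Big (λ j → ≤-trans lo (min j))) (keep i*) ev lo) (<⇒≱ hi)
    bad-at (inj₂ (e , ev)) min | u , lo , hi =
      u , parts-Big mv (proj₁ ∘ choice) (proj₂ ∘ choice) , combine e i* ,
      subst (λ z → Evenoid k z × k ^ u ≤ z × z < k ^ suc u) (sym (result-combine mv e i*)) (ev , lo , hi)
      where
      choice : ∀ j → ∃ λ t → k ^ u ≤ parts j t
      choice j = large-part {u} (kept-Big (λ j → ≤-trans lo (min j))) j (witness j) (≤-trans lo (min j))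

  -- Keep the evenoid heap e, split into k oddoids below T, and m - 1 further heaps of size at
  -- least T, each split as (z - (k - 1)) + 1 + ⋯ + 1; since T ≡ k mod N, the piece z - (k - 1)
  -- is oddoid if it is below T.  So every evenoid part reaches T, but only m - 1 parts do.
  module Reply {Z : Position k m} (u : ℕ) (g : Fin m → Fin (k * m)) (g-inj : Injective _≡_ _≡_ g)
               (T≤g : ∀ j → k ^ suc u ≤ Z (g j)) (e : Fin (k * m)) (ev : Evenoid k (Z e))
               (T≤e : k ^ suc u ≤ Z e) (e<kT : Z e < k * k ^ suc u) where
    open Avoiding g g-inj e

    T : ℕ
    T = k ^ suc u

    split-e : Σ (Fin k → ℕ) λ f → (∀ t → Oddoid k (f t)) × (∀ t → f t < T) × sumF f ≡ Z e
    split-e = evenoid-split u ev (≤-trans (m^n>0 k (suc u)) T≤e) e<kT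

    f : Fin k → ℕ
    f = proj₁ split-e

    f-odd : ∀ t → Oddoid k (f t)
    f-odd = proj₁ (proj₂ split-e)

    f<T : ∀ t → f t < T
    f<T = proj₁ (proj₂ (proj₂ split-e))

    T≤avoid : ∀ j → T ≤ Z (avoid j)
    T≤avoid j with avoid-image j
    ... | i , ≡gi = subst (λ y → T ≤ Z y) (sym ≡gi) (T≤g i)

    k-1≤avoid : ∀ j → suc k′ ≤ Z (avoid j)
    k-1≤avoid j = ≤-trans (n≤1+n (suc k′)) (≤-trans (k≤k^suc u) (T≤avoid j))

    parts : Fin m → Fin k → ℕ
    parts = f ∷ λ j → (Z (avoid j) ∸ suc k′) ∷ const 1

    parts-pos : ∀ i t → 1 ≤ parts i t
    parts-pos fz t = oddoid-pos (f-odd t)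
    parts-pos (fs j) fz = m+n≤o⇒m≤o∸n 1 (≤-trans (k≤k^suc u) (T≤avoid j))
    parts-pos (fs j) (fs t) = ≤-refl

    parts-sum : ∀ i → sumF (parts i) ≡ Z ((e ∷ avoid) i)
    parts-sum fz = proj₂ (proj₂ (proj₂ split-e))
    parts-sum (fs j) = trans (cong (Z (avoid j) ∸ suc k′ +_) (trans (sumF-const (suc k′) 1) (*-identityʳ _)))
                             (m∸n+n≡m (k-1≤avoid j))

    Z′ : Position k m
    Z′ x = parts (proj₂ (remQuot {k} m x)) (proj₁ (remQuot {k} m x))

    move : Move k m Z Z′
    move = record { keep = e ∷ avoid ; keep-inj = ∷-injective avoid-injective avoid≢e
                  ; parts = parts ; parts-pos = parts-pos ; parts-sum = parts-sum ; result = λ _ → refl }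

    small-part-oddoid : ∀ i t → parts i t < T → Oddoid k (parts i t)
    small-part-oddoid fz t _ = f-odd t
    small-part-oddoid (fs j) fz <T =
      oddoid-below-power u (subst (T ≤_) (sym (m∸n+n≡m (k-1≤avoid j))) (T≤avoid j)) <T
    small-part-oddoid (fs j) (fs t) _ = 0 , 1 , refl , ≤-refl , s≤s z≤n

    large-part-index : ∀ i t → T ≤ parts i t → ∃ λ p → i ≡ fs p × t ≡ fz
    large-part-index fz t T≤ = contradiction (f<T t) (≤⇒≯ T≤)
    large-part-index (fs p) fz _ = p , refl , refl
    large-part-index (fs p) (fs t) T≤ = contradiction (≤-trans (k≤k^suc u) T≤) (<⇒≱ (s≤s (s≤s z≤n)))

    evenoid-part-large : ∀ i t → Evenoid k (parts i t) → T ≤ parts i t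
    evenoid-part-large i t ev with T ≤? parts i t
    ... | yes T≤ = T≤
    ... | no T≰ = contradiction (small-part-oddoid i t (≰⇒> T≰)) ev

    covered : ∀ x → T ≤ Z′ x → ∃ λ p → x ≡ combine {k} fz (fs p)
    covered x T≤ =
      let (p , i≡ , t≡) = large-part-index (proj₂ (remQuot {k} m x)) (proj₁ (remQuot {k} m x)) T≤
      in p , trans (sym (Fin.combine-remQuot {k} m x)) (cong₂ combine t≡ i≡)

    few-large : ¬ Big Z′ T
    few-large = few-large⇒¬Big {Z′} (λ p → combine {k} fz (fs p)) covered

    evenoid-large : ∀ x → Evenoid k (Z′ x) → T ≤ Z′ x
    evenoid-large x = evenoid-part-large (proj₂ (remQuot {k} m x)) (proj₁ (remQuot {k} m x))

    good : Good Z′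
    good = evenoids-above⇒Good {Z′} (suc u) few-large evenoid-large

    reply : Σ (Position k m) λ Z′ → Move k m Z Z′ × Good Z′
    reply = Z′ , move , good

  Bad⇒moves-to-Good : ∀ {Z} → Bad Z → Σ (Position k m) λ Z′ → Move k m Z Z′ × Good Z′
  Bad⇒moves-to-Good {Z} (zero , _ , x , ev , 1≤ , <k) =
    contradiction (subst (Z x <_) (*-identityʳ k) <k) (≤⇒≯ (evenoid⇒k≤ ev 1≤))
  Bad⇒moves-to-Good (suc u , (g , g-inj , T≤g) , e , ev , T≤e , e<kT) = Reply.reply u g g-inj T≤g e ev T≤e e<kT

  P-N-disjoint : ∀ {Z} → PPos k m Z → NPos k m Z → ⊥
  P-N-disjoint (ppos P) (npos Z′ mv P′) = P-N-disjoint P′ (P Z′ mv)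

  outcome : ∀ B {Z} → (∀ x → Z x ≤ B) → (Good Z → PPos k m Z) × (Bad Z → NPos k m Z)
  outcome zero Z≤0 =
    (λ _ → ppos λ _ mv → contradiction (Z≤0 (Move.keep mv fz)) (<⇒≱ (heap-pos mv fz))) ,
    λ { (u , _ , x , _ , lo , _) → contradiction (≤-trans lo (Z≤0 x)) (<⇒≱ (m^n>0 k u)) }
  outcome (suc B) Z≤ =
    (λ good → ppos λ Z′ mv → proj₂ (outcome B (move-shrinks mv Z≤)) (Good⇒moves-to-Bad good mv)) ,
    λ bad → let (Z′ , mv , good′) = Bad⇒moves-to-Good bad
            in npos Z′ mv (proj₁ (outcome B (move-shrinks mv Z≤)) good′)

  Good⇒P : ∀ {Z} → Good Z → PPos k m Z
  Good⇒P {Z} = proj₁ (outcome (sumF Z) (f≤sumF Z))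

  P⇒Good : ∀ {Z} → PPos k m Z → Good Z
  P⇒Good {Z} P u big x ev lo with k ^ suc u ≤? Z x
  ... | yes ≤Zx = ≤Zx
  ... | no ≰Zx = ⊥-elim (P-N-disjoint P (proj₂ (outcome (sumF Z) (f≤sumF Z)) (u , big , x , ev , lo , ≰⇒> ≰Zx)))

module SortedPosition (k′ m′ : ℕ) (Z : Position (suc (suc k′)) (suc m′)) (pos : ∀ i → 1 ≤ Z i)
              (sorted : ∀ i j → toℕ i ≤ toℕ j → Z i ≤ Z j)
              (c : Fin (suc (suc k′) * suc m′)) (c≡ : toℕ c ≡ suc k′ * suc m′)
              (s : ℕ) (Zc<k^s : Z c < suc (suc k′) ^ s) (s-min : ∀ t → Z c < suc (suc k′) ^ t → s ≤ t) where
  open Residues k′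
  open Game k′ m′

  C : ℕ
  C = toℕ c

  k*m≡C+m : k * m ≡ C + m
  k*m≡C+m = trans (+-comm m _) (cong (_+ m) (sym c≡))

  ≤⇒Big : ∀ {v} → v ≤ Z c → Big Z v
  ≤⇒Big v≤ = g , g-inj , λ j → ≤-trans v≤ (sorted c (g j) (subst (C ≤_) (sym (Fin.toℕ-fromℕ< (lt j))) (m≤m+n C _)))
    where
    lt : ∀ j → C + toℕ j < k * m
    lt j = subst (C + toℕ j <_) (sym k*m≡C+m) (+-monoʳ-< C (Fin.toℕ<n j))
    g : Fin m → Fin (k * m)
    g j = fromℕ< (lt j)
    g-inj : Injective _≡_ _≡_ g
    g-inj {i} {j} eq = Fin.toℕ-injective (+-cancelˡ-≡ C _ _
      (trans (sym (Fin.toℕ-fromℕ< (lt i))) (trans (cong toℕ eq) (Fin.toℕ-fromℕ< (lt j)))))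

  Big⇒≤ : ∀ {v} → Big Z v → v ≤ Z c
  Big⇒≤ {v} big with v ≤? Z c
  ... | yes v≤ = v≤
  ... | no v≰ = contradiction big (few-large⇒¬Big ι covered)
    where
    lt : ∀ p → suc C + toℕ p < k * m
    lt p = subst (suc C + toℕ p <_) (trans (sym (+-suc C m′)) (sym k*m≡C+m)) (s≤s (+-monoʳ-< C (Fin.toℕ<n p)))
    ι : Fin m′ → Fin (k * m)
    ι p = fromℕ< (lt p)
    C<x : ∀ {x} → v ≤ Z x → C < toℕ x
    C<x {x} v≤ with toℕ x ≤? C
    ... | yes x≤C = contradiction (≤-trans v≤ (sorted x c x≤C)) v≰
    ... | no x≰C = ≰⇒> x≰C
    covered : ∀ x → v ≤ Z x → ∃ λ p → x ≡ ι p
    covered x v≤ = fromℕ< below , Fin.toℕ-injective (begin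
      toℕ x                                   ≡⟨ m+[n∸m]≡n (C<x v≤) ⟨
      suc C + (toℕ x ∸ suc C)                 ≡⟨ cong (suc C +_) (Fin.toℕ-fromℕ< below) ⟨
      suc C + toℕ (fromℕ< below)              ≡⟨ Fin.toℕ-fromℕ< (lt (fromℕ< below)) ⟨
      toℕ (ι (fromℕ< below))                  ∎)
      where
      open ≡-Reasoning
      below : toℕ x ∸ suc C < m′
      below = subst (toℕ x ∸ suc C <_) (m+n∸m≡n (suc C) m′)
        (∸-monoˡ-< (subst (toℕ x <_) (trans k*m≡C+m (+-suc C m′)) (Fin.toℕ<n x)) (C<x v≤))

  Good⇒evenoids-above-k^s : Good Z → ∀ l → Evenoid k (Z l) → k ^ s ≤ Z l
  Good⇒evenoids-above-k^s good l ev = powers s ≤-refl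
    where
    powers : ∀ u → u ≤ s → k ^ u ≤ Z l
    powers zero _ = pos l
    powers (suc u) u<s = good u (≤⇒Big k^u≤Zc) l ev (powers u (<⇒≤ u<s))
      where
      k^u≤Zc : k ^ u ≤ Z c
      k^u≤Zc with k ^ u ≤? Z c
      ... | yes ≤Zc = ≤Zc
      ... | no ≰Zc = contradiction (s-min u (≰⇒> ≰Zc)) (<⇒≱ u<s)

  evenoids-above-k^s⇒Good : (∀ l → Evenoid k (Z l) → k ^ s ≤ Z l) → Good Z
  evenoids-above-k^s⇒Good = evenoids-above⇒Good s (λ big → <⇒≱ Zc<k^s (Big⇒≤ big))

  evenoids-above-k^s⇒prefix-oddoid : (∀ l → Evenoid k (Z l) → k ^ s ≤ Z l) →
                                     ∀ i → toℕ i ≤ suc k′ * m → Oddoid k (Z i)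
  evenoids-above-k^s⇒prefix-oddoid above i i≤C with oddoid? (Z i)
  ... | yes odd = odd
  ... | no ev = contradiction (≤-trans (above i ev) (sorted i c (subst (toℕ i ≤_) (sym c≡) i≤C))) (<⇒≱ Zc<k^s)

theorem5p6 : (k m : ℕ) → 2 ≤ k → 1 ≤ m → (Z : Position k m)
    → (∀ i → 1 ≤ Z i)
    → (∀ i j → toℕ i ≤ toℕ j → Z i ≤ Z j)
    → (c : Fin (k * m)) → toℕ c ≡ (k ∸ 1) * m
    → (s : ℕ) → Z c < k ^ s → (∀ t → Z c < k ^ t → s ≤ t)
    → PPos k m Z ⇔ ((∀ i → toℕ i ≤ (k ∸ 1) * m → Oddoid k (Z i))
                    × (∀ l → Evenoid k (Z l) → k ^ s ≤ Z l))
theorem5p6 (suc (suc k′)) (suc m′) (s≤s (s≤s z≤n)) (s≤s z≤n) Z pos sorted c c≡ s Zc<k^s s-min =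
  mk⇔ (λ P → let above = Good⇒evenoids-above-k^s (P⇒Good P)
             in evenoids-above-k^s⇒prefix-oddoid above , above)
      (λ (_ , above) → Good⇒P (evenoids-above-k^s⇒Good above))
  where
  open Game k′ m′
  open SortedPosition k′ m′ Z pos sorted c c≡ s Zc<k^s s-min
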